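{- For every $\nu\in\mathbb{N}$, \[P_\nu(\xi)=\frac{(-i)^\nu}{\nu!}\operatorname{He}_\nu(i\xi)=\frac{e^{ -\xi^2/2}}{\nu!}\frac{d^\nu}{d\xi^\nu}e^{\xi^2/2}=\Big(\xi+\frac{d}{d\xi}\Big)^\nu\cdot\frac1{\nu!}=\sum_{a=0}^{\lfloor\nu/2\rfloor}\frac{\xi^{\nu-2a}}{a!(\nu-2a)!2^a}.\] In particular, $P_\nu$ has degree $\nu$ and parity $(-1)^\nu$, $\nu!P_\nu\in\mathbb{Z}[\xi]$, and $P_\nu(0)$ equals $\frac{1}{2^{\nu/2}(\nu/2)!}$ for even $\nu$ and $0$ for odd $\nu$.
   Context: $P_\nu,Q_\nu\in\mathbb{Q}[\xi]$ are the unique polynomials with $P_0=1$, $Q_0=0$ and, for $\nu\ge1$, $P_\nu'=P_{\nu-1}$ and $P_\nu+Q_\nu'-\xi Q_\nu=Q_{\nu-1}$. $\operatorname{He}_n(\xi)=(-1)^ne^{\xi^2/2}\frac{d^n}{d\xi^n}e^{ -\xi^2/2}$ are the probabilists' Hermite polynomials. -}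

module Defs where

open import Data.Nat as ℕ using (ℕ; zero; suc; _∸_; _≤_; _<_; ⌊_/2⌋; _!)
open import Data.Nat.Properties using (_!≢0)
open import Data.Integer as ℤ using (ℤ; +_)
open import Data.Rational as ℚ using (ℚ; 0ℚ; 1ℚ)
open import Relation.Binary.PropositionalEquality using (_≡_)
open import Data.Product using (∃; _×_)

-- Formal power series / polynomials over a ring A, represented by their
-- coefficient sequences  f : ℕ → A  (f k = coefficient of ξ^k).

module SeqOps {A : Set} (_+_ _*_ : A → A → A) (0# 1# : A) where

  Seq : Set
  Seq = ℕ → A

  natA : ℕ → A
  natA zero    = 0#
  natA (suc n) = 1# + natA n

  pow : A → ℕ → A
  pow x zero    = 1#
  pow x (suc n) = x * pow x n

  D : Seq → Seq
  D f n = natA (suc n) * f (suc n)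

  Dⁿ : ℕ → Seq → Seq
  Dⁿ zero    f = f
  Dⁿ (suc n) f = D (Dⁿ n f)

  X : Seq → Seq
  X f zero    = 0#
  X f (suc n) = f n

  _⊕_ : Seq → Seq → Seq
  (f ⊕ g) n = f n + g n

  _·_ : A → Seq → Seq
  (c · f) n = c * f n

  const : A → Seq
  const c zero    = c
  const c (suc n) = 0#

  mono : A → ℕ → Seq
  mono c zero    zero    = c
  mono c zero    (suc k) = 0#
  mono c (suc m) zero    = 0#
  mono c (suc m) (suc k) = mono c m k

  sumTo : ℕ → (ℕ → A) → A
  sumTo zero    h = h 0
  sumTo (suc n) h = sumTo n h + h (suc n)

  _⋆_ : Seq → Seq → Seq
  (f ⋆ g) n = sumTo n (λ k → f k * g (n ∸ k))

  iter : ℕ → (Seq → Seq) → Seq → Seq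
  iter zero    T f = f
  iter (suc n) T f = T (iter n T f)

  IsPoly : Seq → Set
  IsPoly f = ∃ λ N → ∀ n → N ≤ n → f n ≡ 0#

open SeqOps ℚ._+_ ℚ._*_ 0ℚ 1ℚ public

invFact : ℕ → ℚ
invFact m = (+ 1) ℚ./ (m !) where instance _ = m !≢0

½ : ℚ
½ = (+ 1) ℚ./ 2

-- coefficient sequence of the formal power series exp(c ξ²)
expSq : ℚ → Seq
expSq c n = go n (n ℕ.% 2)
  where
  go : ℕ → ℕ → ℚ
  go n zero    = pow c ⌊ n /2⌋ ℚ.* invFact ⌊ n /2⌋
  go n (suc _) = 0ℚ

E⁺ : Seq
E⁺ = expSq ½

E⁻ : Seq
E⁻ = expSq (ℚ.- ½)

He : ℕ → Seq
He n = pow (ℚ.- 1ℚ) n · (E⁺ ⋆ Dⁿ n E⁻)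

-- Gaussian rationals ℚ[i] (needed for He_ν(iξ) and (-i)^ν)

record ℚi : Set where
  constructor _+i_
  field
    re : ℚ
    im : ℚ

_+ᶜ_ : ℚi → ℚi → ℚi
(a +i b) +ᶜ (c +i d) = (a ℚ.+ c) +i (b ℚ.+ d)

_*ᶜ_ : ℚi → ℚi → ℚi
(a +i b) *ᶜ (c +i d) = ((a ℚ.* c) ℚ.- (b ℚ.* d)) +i ((a ℚ.* d) ℚ.+ (b ℚ.* c))

ι : ℚ → ℚi
ι a = a +i 0ℚ

𝕚 : ℚi
𝕚 = 0ℚ +i 1ℚ

module C = SeqOps _+ᶜ_ _*ᶜ_ (ι 0ℚ) (ι 1ℚ)

substI : Seq → C.Seq
substI f k = C.pow 𝕚 k *ᶜ ι (f k)

IsPQ : (ℕ → Seq) → (ℕ → Seq) → Set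
IsPQ P Q =
  (∀ ν → IsPoly (P ν)) × (∀ ν → IsPoly (Q ν)) ×
  (∀ k → P 0 k ≡ const 1ℚ k) × (∀ k → Q 0 k ≡ 0ℚ) ×
  (∀ ν k → D (P (suc ν)) k ≡ P ν k) ×
  (∀ ν k → (P (suc ν) k ℚ.+ D (Q (suc ν)) k) ℚ.- X (Q (suc ν)) k ≡ Q ν k)

module Submission where

-- The relations determine P and Q degree by degree: P′ₙ = Pₙ₋₁ fixes Pₙ up to its constant term, the
-- second relation then fixes Qₙ (a polynomial, so its coefficients are recovered from the top down)
-- and with it that constant. Hence it suffices to exhibit one solution, 𝒫ₙ = (ξ + d/dξ)ⁿ 1 / n!, whose
-- relations follow from [d/dξ, ξ] = 1. Everything else is a computation on 𝒫: conjugating d/dξ by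
-- the Gaussian turns it into ξ + d/dξ, substituting ξ ↦ iξ turns d/dξ − ξ into −i (ξ + d/dξ), and the
-- coefficients of (ξ + d/dξ)ⁿ 1 are the natural numbers n!/(a! k! 2ᵃ) for n = k + 2a and 0 otherwise.

open import Defs
open import Data.Nat as ℕ using (ℕ; zero; suc; _!; _<_; _≤_; _⊔_; _∸_; _%_; _^_; ⌊_/2⌋; s≤s; z≤n)
import Data.Nat.Properties as ℕP
open import Data.Nat.DivMod using (m*n%n≡0; [m+kn]%n≡m%n)
open import Data.Nat.Tactic.RingSolver using (solve-∀)
open import Data.Integer as ℤ using (ℤ)
import Data.Integer.Solver as ℤS
open import Data.Rational as ℚ using (ℚ; 0ℚ; 1ℚ; _+_; _*_; -_; _-_)
import Data.Rational.Properties as ℚP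
import Data.Rational.Unnormalised as ℚᵘ
import Data.Rational.Unnormalised.Properties as ℚᵘP
open import Data.Rational.Solver using (module +-*-Solver)
open import Data.Product using (∃; _×_; _,_; proj₁; proj₂)
open import Data.Empty using (⊥-elim)
open import Function using (_∘′_)
open import Level using (0ℓ)
open import Algebra.Bundles using (CommutativeRing)
open import Algebra.Structures using (IsCommutativeRing)
open import Algebra.Properties.Group ℚP.+-0-group using (x∙y⁻¹≈ε⇒x≈y)
import Algebra.Solver.Ring.AlmostCommutativeRing as ACR
import Algebra.Solver.Ring.Simple as SimpleSolver
open import Relation.Nullary using (yes; no)
open import Relation.Binary.Definitions using (DecidableEquality)
open import Relation.Binary.PropositionalEquality

-- Identities between fractions are checked in ℚᵘ, where equality is cross-multiplication.
module _ where
  open ℚᵘP.≃-Reasoning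
  open ℤS.+-*-Solver

  private
    toℚᵘ-/ : ∀ z d .{{_ : ℕ.NonZero d}} → ℚ.toℚᵘ (z ℚ./ d) ℚᵘ.≃ ℚᵘ.mkℚᵘ z (ℕ.pred d)
    toℚᵘ-/ z (suc d) = ℚP.toℚᵘ-fromℚᵘ (ℚᵘ.mkℚᵘ z d)

  natA≡/1 : ∀ n → natA n ≡ ℤ.+ n ℚ./ 1
  natA≡/1 zero    = refl
  natA≡/1 (suc n) = ℚP.toℚᵘ-injective (begin
    ℚ.toℚᵘ (1ℚ + natA n)                ≈⟨ ℚP.toℚᵘ-homo-+ 1ℚ (natA n) ⟩
    ℚᵘ.1ℚᵘ ℚᵘ.+ ℚ.toℚᵘ (natA n)         ≈⟨ ℚᵘP.+-congʳ ℚᵘ.1ℚᵘ (ℚᵘP.≃-trans (ℚP.toℚᵘ-cong (natA≡/1 n)) (toℚᵘ-/ (ℤ.+ n) 1)) ⟩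
    ℚᵘ.1ℚᵘ ℚᵘ.+ ℚᵘ.mkℚᵘ (ℤ.+ n) 0       ≈⟨ ℚᵘ.*≡* (solve 1 (λ x → (con (ℤ.+ 1) :* con (ℤ.+ 1) :+ x :* con (ℤ.+ 1)) :* con (ℤ.+ 1) := (con (ℤ.+ 1) :+ x) :* (con (ℤ.+ 1) :* con (ℤ.+ 1))) refl (ℤ.+ n)) ⟩
    ℚᵘ.mkℚᵘ (ℤ.+ suc n) 0               ≈⟨ toℚᵘ-/ (ℤ.+ suc n) 1 ⟨
    ℚ.toℚᵘ (ℤ.+ suc n ℚ./ 1)            ∎)

  1/n*n≡1 : ∀ n .{{_ : ℕ.NonZero n}} → (ℤ.+ 1 ℚ./ n) * natA n ≡ 1ℚ
  1/n*n≡1 (suc n) = ℚP.toℚᵘ-injective (begin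
    ℚ.toℚᵘ ((ℤ.+ 1 ℚ./ suc n) * natA (suc n))    ≈⟨ ℚP.toℚᵘ-homo-* (ℤ.+ 1 ℚ./ suc n) (natA (suc n)) ⟩
    ℚ.toℚᵘ (ℤ.+ 1 ℚ./ suc n) ℚᵘ.* ℚ.toℚᵘ (natA (suc n))
      ≈⟨ ℚᵘP.*-cong (toℚᵘ-/ (ℤ.+ 1) (suc n)) (ℚᵘP.≃-trans (ℚP.toℚᵘ-cong (natA≡/1 (suc n))) (toℚᵘ-/ (ℤ.+ suc n) 1)) ⟩
    ℚᵘ.mkℚᵘ (ℤ.+ 1) n ℚᵘ.* ℚᵘ.mkℚᵘ (ℤ.+ suc n) 0 ≈⟨ ℚᵘ.*≡* (solve 1 (λ x → (con (ℤ.+ 1) :* (con (ℤ.+ 1) :+ x)) :* con (ℤ.+ 1) := con (ℤ.+ 1) :* ((con (ℤ.+ 1) :+ x) :* con (ℤ.+ 1))) refl (ℤ.+ n)) ⟩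
    ℚᵘ.1ℚᵘ                                       ∎)

open ≡-Reasoning
open +-*-Solver

natA-+ : ∀ m n → natA (m ℕ.+ n) ≡ natA m + natA n
natA-+ zero    n = sym (ℚP.+-identityˡ (natA n))
natA-+ (suc m) n = trans (cong (1ℚ +_) (natA-+ m n)) (sym (ℚP.+-assoc 1ℚ (natA m) (natA n)))

natA-* : ∀ m n → natA (m ℕ.* n) ≡ natA m * natA n
natA-* zero    n = sym (ℚP.*-zeroˡ (natA n))
natA-* (suc m) n = begin
  natA (n ℕ.+ m ℕ.* n)      ≡⟨ natA-+ n (m ℕ.* n) ⟩
  natA n + natA (m ℕ.* n)   ≡⟨ cong (natA n +_) (natA-* m n) ⟩
  natA n + natA m * natA n  ≡⟨ solve 2 (λ a b → a :+ b :* a := (con 1ℚ :+ b) :* a) refl (natA n) (natA m) ⟩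
  (1ℚ + natA m) * natA n    ∎

natA-cancelˡ : ∀ n .{{_ : ℕ.NonZero n}} {x y} → natA n * x ≡ natA n * y → x ≡ y
natA-cancelˡ n {x} {y} eq = trans (sym (undo x)) (trans (cong (n⁻¹ *_) eq) (undo y))
  where
  n⁻¹ : ℚ
  n⁻¹ = ℤ.+ 1 ℚ./ n
  undo : ∀ z → n⁻¹ * (natA n * z) ≡ z
  undo z = trans (sym (ℚP.*-assoc n⁻¹ (natA n) z)) (trans (cong (_* z) (1/n*n≡1 n)) (ℚP.*-identityˡ z))

inverse-unique : ∀ {x y m} → x * m ≡ 1ℚ → y * m ≡ 1ℚ → x ≡ y
inverse-unique {x} {y} {m} xm≡1 ym≡1 = begin
  x            ≡⟨ sym (ℚP.*-identityʳ x) ⟩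
  x * 1ℚ       ≡⟨ cong (x *_) (sym ym≡1) ⟩
  x * (y * m)  ≡⟨ solve 3 (λ x y m → x :* (y :* m) := y :* (x :* m)) refl x y m ⟩
  y * (x * m)  ≡⟨ cong (y *_) xm≡1 ⟩
  y * 1ℚ       ≡⟨ ℚP.*-identityʳ y ⟩
  y            ∎

invFact-*-! : ∀ n → invFact n * natA (n !) ≡ 1ℚ
invFact-*-! n = 1/n*n≡1 (n !) {{n ℕP.!≢0}}

invFact-suc : ∀ n → invFact (suc n) * natA (suc n) ≡ invFact n
invFact-suc n = inverse-unique (begin
  invFact (suc n) * natA (suc n) * natA (n !)    ≡⟨ ℚP.*-assoc (invFact (suc n)) (natA (suc n)) (natA (n !)) ⟩
  invFact (suc n) * (natA (suc n) * natA (n !))  ≡⟨ cong (invFact (suc n) *_) (sym (natA-* (suc n) (n !))) ⟩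
  invFact (suc n) * natA (suc n !)               ≡⟨ invFact-*-! (suc n) ⟩
  1ℚ                                             ∎) (invFact-*-! n)

D-cong : ∀ {f g} → f ≗ g → D f ≗ D g
D-cong f≗g k = cong (natA (suc k) *_) (f≗g (suc k))

X-cong : ∀ {f g} → f ≗ g → X f ≗ X g
X-cong f≗g zero    = refl
X-cong f≗g (suc k) = f≗g k

D-⊕ : ∀ f g → D (f ⊕ g) ≗ D f ⊕ D g
D-⊕ f g k = ℚP.*-distribˡ-+ (natA (suc k)) (f (suc k)) (g (suc k))

X-⊕ : ∀ f g → X (f ⊕ g) ≗ X f ⊕ X g
X-⊕ f g zero    = refl
X-⊕ f g (suc k) = refl

D-· : ∀ c f → D (c · f) ≗ c · D f
D-· c f k = solve 3 (λ a c x → a :* (c :* x) := c :* (a :* x)) refl (natA (suc k)) c (f (suc k))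

X-· : ∀ c f → X (c · f) ≗ c · X f
X-· c f zero    = sym (ℚP.*-zeroʳ c)
X-· c f (suc k) = refl

D-const : ∀ c k → D (const c) k ≡ 0ℚ
D-const c k = ℚP.*-zeroʳ (natA (suc k))

D-X : ∀ f → D (X f) ≗ X (D f) ⊕ f
D-X f zero    = trans (ℚP.*-identityˡ (f 0)) (sym (ℚP.+-identityˡ (f 0)))
D-X f (suc k) = solve 2 (λ a x → (con 1ℚ :+ a) :* x := a :* x :+ x) refl (natA (suc k)) (f (suc k))

ξ+∂ : Seq → Seq
ξ+∂ f = X f ⊕ D f

ξ+∂-cong : ∀ {f g} → f ≗ g → ξ+∂ f ≗ ξ+∂ g
ξ+∂-cong f≗g k = cong₂ _+_ (X-cong f≗g k) (D-cong f≗g k)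

ξ+∂-· : ∀ c f → ξ+∂ (c · f) ≗ c · ξ+∂ f
ξ+∂-· c f k = trans (cong₂ _+_ (X-· c f k) (D-· c f k)) (sym (ℚP.*-distribˡ-+ c (X f k) (D f k)))

D-ξ+∂ : ∀ f → D (ξ+∂ f) ≗ ξ+∂ (D f) ⊕ f
D-ξ+∂ f k = begin
  D (X f ⊕ D f) k                 ≡⟨ D-⊕ (X f) (D f) k ⟩
  D (X f) k + D (D f) k           ≡⟨ cong (_+ D (D f) k) (D-X f k) ⟩
  (X (D f) k + f k) + D (D f) k   ≡⟨ solve 3 (λ a b c → (a :+ b) :+ c := (a :+ c) :+ b) refl (X (D f) k) (f k) (D (D f) k) ⟩
  ξ+∂ (D f) k + f k               ∎

-- The solution 𝒫ₙ = (ξ + d/dξ)ⁿ 1 / n! and its companion 𝒬ₙ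

R : ℕ → Seq
R n = iter n ξ+∂ (const 1ℚ)

r : ℕ → ℕ → ℕ
r zero    zero    = 1
r zero    (suc k) = 0
r (suc n) zero    = r n 1
r (suc n) (suc k) = r n k ℕ.+ suc (suc k) ℕ.* r n (suc (suc k))

R≡r : ∀ n k → R n k ≡ natA (r n k)
R≡r zero    zero    = refl
R≡r zero    (suc k) = refl
R≡r (suc n) zero    = trans (cong (λ x → 0ℚ + natA 1 * x) (R≡r n 1)) (solve 1 (λ x → con 0ℚ :+ con 1ℚ :* x := x) refl (natA (r n 1)))
R≡r (suc n) (suc k) = begin
  R n k + natA (2 ℕ.+ k) * R n (2 ℕ.+ k)                  ≡⟨ cong₂ (λ x y → x + natA (2 ℕ.+ k) * y) (R≡r n k) (R≡r n (2 ℕ.+ k)) ⟩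
  natA (r n k) + natA (2 ℕ.+ k) * natA (r n (2 ℕ.+ k))    ≡⟨ cong (natA (r n k) +_) (sym (natA-* (2 ℕ.+ k) (r n (2 ℕ.+ k)))) ⟩
  natA (r n k) + natA ((2 ℕ.+ k) ℕ.* r n (2 ℕ.+ k))         ≡⟨ sym (natA-+ (r n k) ((2 ℕ.+ k) ℕ.* r n (2 ℕ.+ k))) ⟩
  natA (r (suc n) (suc k))                                ∎

r-deg : ∀ {n k} → n < k → r n k ≡ 0
r-deg {zero}  {suc k} _         = refl
r-deg {suc n} {suc k} (s≤s n<k) rewrite r-deg n<k | r-deg (ℕP.m<n⇒m<1+n (ℕP.m<n⇒m<1+n n<k)) = ℕP.*-zeroʳ (2 ℕ.+ k)

r-top : ∀ n → r n n ≡ 1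
r-top zero    = refl
r-top (suc n) rewrite r-top n | r-deg (ℕP.m<n⇒m<1+n (ℕP.n<1+n n)) = cong suc (ℕP.*-zeroʳ (2 ℕ.+ n))

ξ+∂-vanishing : ∀ {f} → (∀ k → f k ≡ 0ℚ) → ∀ k → ξ+∂ f k ≡ 0ℚ
ξ+∂-vanishing {f} f≡0 zero    = cong (λ x → 0ℚ + natA 1 * x) (f≡0 1)
ξ+∂-vanishing {f} f≡0 (suc k) = trans (cong₂ (λ x y → x + natA (2 ℕ.+ k) * y) (f≡0 k) (f≡0 (2 ℕ.+ k)))
                                       (trans (ℚP.+-identityˡ _) (ℚP.*-zeroʳ (natA (2 ℕ.+ k))))

D-R : ∀ n → D (R (suc n)) ≗ natA (suc n) · R n
D-R zero    k = begin
  D (ξ+∂ (const 1ℚ)) k               ≡⟨ D-ξ+∂ (const 1ℚ) k ⟩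
  ξ+∂ (D (const 1ℚ)) k + const 1ℚ k  ≡⟨ cong (_+ const 1ℚ k) (ξ+∂-vanishing (D-const 1ℚ) k) ⟩
  0ℚ + const 1ℚ k                    ≡⟨ trans (ℚP.+-identityˡ (const 1ℚ k)) (sym (ℚP.*-identityˡ (const 1ℚ k))) ⟩
  natA 1 * const 1ℚ k                ∎
D-R (suc n) k = begin
  D (ξ+∂ (R (suc n))) k                            ≡⟨ D-ξ+∂ (R (suc n)) k ⟩
  ξ+∂ (D (R (suc n))) k + R (suc n) k              ≡⟨ cong (_+ R (suc n) k) (trans (ξ+∂-cong (D-R n) k) (ξ+∂-· (natA (suc n)) (R n) k)) ⟩
  natA (suc n) * R (suc n) k + R (suc n) k         ≡⟨ solve 2 (λ a x → a :* x :+ x := (con 1ℚ :+ a) :* x) refl (natA (suc n)) (R (suc n) k) ⟩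
  natA (2 ℕ.+ n) * R (suc n) k                     ∎

iter-ξ+∂-const : ∀ n c → iter n ξ+∂ (const c) ≗ c · R n
iter-ξ+∂-const zero    c zero    = sym (ℚP.*-identityʳ c)
iter-ξ+∂-const zero    c (suc k) = sym (ℚP.*-zeroʳ c)
iter-ξ+∂-const (suc n) c k       = trans (ξ+∂-cong (iter-ξ+∂-const n c) k) (ξ+∂-· c (R n) k)

𝒫 : ℕ → Seq
𝒫 n = invFact n · R n

𝒫-coeff : ∀ n k → 𝒫 n k ≡ invFact n * natA (r n k)
𝒫-coeff n k = cong (invFact n *_) (R≡r n k)

𝒫-deg : ∀ {n k} → n < k → 𝒫 n k ≡ 0ℚ
𝒫-deg {n} {k} n<k = trans (𝒫-coeff n k) (trans (cong (λ m → invFact n * natA m) (r-deg n<k)) (ℚP.*-zeroʳ (invFact n)))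

D-𝒫 : ∀ n → D (𝒫 (suc n)) ≗ 𝒫 n
D-𝒫 n k = begin
  D (invFact (suc n) · R (suc n)) k              ≡⟨ D-· (invFact (suc n)) (R (suc n)) k ⟩
  invFact (suc n) * D (R (suc n)) k              ≡⟨ cong (invFact (suc n) *_) (D-R n k) ⟩
  invFact (suc n) * (natA (suc n) * R n k)       ≡⟨ sym (ℚP.*-assoc (invFact (suc n)) (natA (suc n)) (R n k)) ⟩
  (invFact (suc n) * natA (suc n)) * R n k       ≡⟨ cong (_* R n k) (invFact-suc n) ⟩
  invFact n * R n k                              ∎

𝒫-step : ∀ n → natA (suc n) · 𝒫 (suc n) ≗ ξ+∂ (𝒫 n)
𝒫-step n k = begin
  natA (suc n) * (invFact (suc n) * ξ+∂ (R n) k)  ≡⟨ solve 3 (λ a i x → a :* (i :* x) := (i :* a) :* x) refl (natA (suc n)) (invFact (suc n)) (ξ+∂ (R n) k) ⟩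
  (invFact (suc n) * natA (suc n)) * ξ+∂ (R n) k  ≡⟨ cong (_* ξ+∂ (R n) k) (invFact-suc n) ⟩
  invFact n * ξ+∂ (R n) k                         ≡⟨ sym (ξ+∂-· (invFact n) (R n) k) ⟩
  ξ+∂ (𝒫 n) k                                     ∎

𝒬 : ℕ → Seq
𝒬 zero    _ = 0ℚ
𝒬 (suc n)   = (ℤ.+ 1 ℚ./ suc n) · (𝒫 n ⊕ D (𝒬 n))

𝒬-step : ∀ n → natA (suc n) · 𝒬 (suc n) ≗ 𝒫 n ⊕ D (𝒬 n)
𝒬-step n k = begin
  natA (suc n) * ((ℤ.+ 1 ℚ./ suc n) * y)     ≡⟨ solve 3 (λ a i y → a :* (i :* y) := (i :* a) :* y) refl (natA (suc n)) (ℤ.+ 1 ℚ./ suc n) y ⟩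
  ((ℤ.+ 1 ℚ./ suc n) * natA (suc n)) * y     ≡⟨ cong (_* y) (1/n*n≡1 (suc n)) ⟩
  1ℚ * y                                     ≡⟨ ℚP.*-identityˡ y ⟩
  y                                          ∎
  where y = (𝒫 n ⊕ D (𝒬 n)) k

𝒬-deg : ∀ {n k} → n ≤ k → 𝒬 n k ≡ 0ℚ
𝒬-deg {zero}              _         = refl
𝒬-deg {suc n} {suc k} (s≤s n≤k) = begin
  (ℤ.+ 1 ℚ./ suc n) * (𝒫 n (suc k) + natA (2 ℕ.+ k) * 𝒬 n (2 ℕ.+ k))
    ≡⟨ cong₂ (λ x y → (ℤ.+ 1 ℚ./ suc n) * (x + natA (2 ℕ.+ k) * y)) (𝒫-deg (s≤s n≤k)) (𝒬-deg (ℕP.m≤n⇒m≤1+n (ℕP.m≤n⇒m≤1+n n≤k))) ⟩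
  (ℤ.+ 1 ℚ./ suc n) * (0ℚ + natA (2 ℕ.+ k) * 0ℚ)
    ≡⟨ solve 2 (λ i a → i :* (con 0ℚ :+ a :* con 0ℚ) := con 0ℚ) refl (ℤ.+ 1 ℚ./ suc n) (natA (2 ℕ.+ k)) ⟩
  0ℚ ∎

𝒫₀ : 𝒫 0 ≗ const 1ℚ
𝒫₀ zero    = refl
𝒫₀ (suc k) = refl

𝒬₁ : 𝒬 1 ≗ const 1ℚ
𝒬₁ k = trans (sym (ℚP.*-identityˡ (𝒬 1 k))) (trans (𝒬-step 0 k) (trans (cong₂ _+_ (𝒫₀ k) (D-const 0ℚ k)) (ℚP.+-identityʳ (const 1ℚ k))))

private
  scaled-lhs : ∀ n → natA (2 ℕ.+ n) · (𝒫 (2 ℕ.+ n) ⊕ D (𝒬 (2 ℕ.+ n)))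
                    ≗ (X (𝒫 (suc n)) ⊕ 𝒫 n) ⊕ D (𝒫 (suc n) ⊕ D (𝒬 (suc n)))
  scaled-lhs n k = begin
    c * (𝒫 (2 ℕ.+ n) k + D (𝒬 (2 ℕ.+ n)) k)
      ≡⟨ ℚP.*-distribˡ-+ c (𝒫 (2 ℕ.+ n) k) (D (𝒬 (2 ℕ.+ n)) k) ⟩
    c * 𝒫 (2 ℕ.+ n) k + c * D (𝒬 (2 ℕ.+ n)) k
      ≡⟨ cong₂ _+_ (𝒫-step (suc n) k) (sym (D-· c (𝒬 (2 ℕ.+ n)) k)) ⟩
    ξ+∂ (𝒫 (suc n)) k + D (c · 𝒬 (2 ℕ.+ n)) k
      ≡⟨ cong₂ _+_ (cong (X (𝒫 (suc n)) k +_) (D-𝒫 n k)) (D-cong (𝒬-step (suc n)) k) ⟩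
    (X (𝒫 (suc n)) k + 𝒫 n k) + D (𝒫 (suc n) ⊕ D (𝒬 (suc n))) k ∎
    where c = natA (2 ℕ.+ n)

  scaled-rhs : ∀ n → natA (2 ℕ.+ n) · (X (𝒬 (2 ℕ.+ n)) ⊕ 𝒬 (suc n))
                    ≗ (X (𝒫 (suc n)) ⊕ 𝒫 n) ⊕ D (X (𝒬 (suc n)) ⊕ 𝒬 n)
  scaled-rhs n k = begin
    natA (2 ℕ.+ n) * (X (𝒬 (2 ℕ.+ n)) k + q)
      ≡⟨ solve 3 (λ m x q → (con 1ℚ :+ m) :* (x :+ q) := (con 1ℚ :+ m) :* x :+ (q :+ m :* q)) refl (natA (suc n)) (X (𝒬 (2 ℕ.+ n)) k) q ⟩
    natA (2 ℕ.+ n) * X (𝒬 (2 ℕ.+ n)) k + (q + natA (suc n) * q)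
      ≡⟨ cong₂ (λ x y → x + (q + y)) (trans (sym (X-· (natA (2 ℕ.+ n)) (𝒬 (2 ℕ.+ n)) k)) (trans (X-cong (𝒬-step (suc n)) k) (X-⊕ (𝒫 (suc n)) (D (𝒬 (suc n))) k))) (𝒬-step n k) ⟩
    (X (𝒫 (suc n)) k + X (D (𝒬 (suc n))) k) + (q + (𝒫 n k + D (𝒬 n) k))
      ≡⟨ solve 5 (λ a b q c d → (a :+ b) :+ (q :+ (c :+ d)) := (a :+ c) :+ ((b :+ q) :+ d)) refl (X (𝒫 (suc n)) k) (X (D (𝒬 (suc n))) k) q (𝒫 n k) (D (𝒬 n) k) ⟩
    (X (𝒫 (suc n)) k + 𝒫 n k) + ((X (D (𝒬 (suc n))) k + q) + D (𝒬 n) k)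
      ≡⟨ cong (X (𝒫 (suc n)) k + 𝒫 n k +_) (sym (trans (D-⊕ (X (𝒬 (suc n))) (𝒬 n) k) (cong (_+ D (𝒬 n) k) (D-X (𝒬 (suc n)) k)))) ⟩
    (X (𝒫 (suc n)) k + 𝒫 n k) + D (X (𝒬 (suc n)) ⊕ 𝒬 n) k ∎
    where q = 𝒬 (suc n) k

-- Scaled by n + 2, each side at level n + 1 is the same sequence plus the derivative of that side at
-- level n, so the relation propagates.
𝒫𝒬-relation : ∀ n → 𝒫 (suc n) ⊕ D (𝒬 (suc n)) ≗ X (𝒬 (suc n)) ⊕ 𝒬 n
𝒫𝒬-relation zero    k = begin
  𝒫 1 k + D (𝒬 1) k                ≡⟨ cong₂ _+_ (sym (ℚP.*-identityˡ (𝒫 1 k))) (trans (D-cong 𝒬₁ k) (D-const 1ℚ k)) ⟩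
  natA 1 * 𝒫 1 k + 0ℚ              ≡⟨ cong (_+ 0ℚ) (trans (𝒫-step 0 k) (cong₂ _+_ (X-cong 𝒫₀ k) (trans (D-cong 𝒫₀ k) (D-const 1ℚ k)))) ⟩
  (X (const 1ℚ) k + 0ℚ) + 0ℚ       ≡⟨ cong (λ x → (x + 0ℚ) + 0ℚ) (sym (X-cong 𝒬₁ k)) ⟩
  (X (𝒬 1) k + 0ℚ) + 0ℚ            ≡⟨ ℚP.+-identityʳ (X (𝒬 1) k + 0ℚ) ⟩
  X (𝒬 1) k + 𝒬 0 k                ∎
𝒫𝒬-relation (suc n) k = natA-cancelˡ (2 ℕ.+ n) (begin
  natA (2 ℕ.+ n) * (𝒫 (2 ℕ.+ n) ⊕ D (𝒬 (2 ℕ.+ n))) k    ≡⟨ scaled-lhs n k ⟩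
  S k + D (𝒫 (suc n) ⊕ D (𝒬 (suc n))) k                  ≡⟨ cong (S k +_) (D-cong (𝒫𝒬-relation n) k) ⟩
  S k + D (X (𝒬 (suc n)) ⊕ 𝒬 n) k                        ≡⟨ sym (scaled-rhs n k) ⟩
  natA (2 ℕ.+ n) * (X (𝒬 (2 ℕ.+ n)) ⊕ 𝒬 (suc n)) k      ∎)
  where S = X (𝒫 (suc n)) ⊕ 𝒫 n

-- Uniqueness of solutions

IsPoly-− : ∀ {f g} → IsPoly f → IsPoly g → IsPoly (λ j → f j - g j)
IsPoly-− {f} {g} (N , f≡0) (M , g≡0) = N ⊔ M , λ j N⊔M≤j →
  cong₂ _-_ (f≡0 j (ℕP.m⊔n≤o⇒m≤o N M N⊔M≤j)) (g≡0 j (ℕP.m⊔n≤o⇒n≤o N M N⊔M≤j))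

IsPoly-descent : ∀ d → IsPoly d → (∀ j → d j ≡ natA (2 ℕ.+ j) * d (2 ℕ.+ j)) → ∀ j → d j ≡ 0ℚ
IsPoly-descent d (N , d≡0) step j = vanish N j (ℕP.m≤n+m N j)
  where
  vanish : ∀ m j → N ≤ j ℕ.+ m → d j ≡ 0ℚ
  vanish zero    j N≤j = d≡0 j (subst (N ≤_) (ℕP.+-identityʳ j) N≤j)
  vanish (suc m) j N≤j = begin
    d j                              ≡⟨ step j ⟩
    natA (2 ℕ.+ j) * d (2 ℕ.+ j)     ≡⟨ cong (natA (2 ℕ.+ j) *_) (vanish m (2 ℕ.+ j) (ℕP.m≤n⇒m≤1+n (subst (N ≤_) (ℕP.+-suc j m) N≤j))) ⟩
    natA (2 ℕ.+ j) * 0ℚ              ≡⟨ ℚP.*-zeroʳ (natA (2 ℕ.+ j)) ⟩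
    0ℚ                               ∎

private
  isolateˡ : ∀ a b c {d} → (a + b) - c ≡ d → a ≡ (d + c) - b
  isolateˡ a b c refl = solve 3 (λ a b c → a := (((a :+ b) :- c) :+ c) :- b) refl a b c

  isolateʳ : ∀ a b c {d} → (a + b) - c ≡ d → c ≡ (a + b) - d
  isolateʳ a b c refl = solve 3 (λ a b c → c := (a :+ b) :- ((a :+ b) :- c)) refl a b c

  cancel-rel : ∀ a b c {d} → a + b ≡ c + d → (a + b) - c ≡ d
  cancel-rel a b c {d} eq = trans (cong (_- c) eq) (solve 2 (λ c d → (c :+ d) :- c := d) refl c d)

IsPQ-unique : ∀ {P Q P′ Q′} → IsPQ P Q → IsPQ P′ Q′ → ∀ ν → P ν ≗ P′ ν × Q ν ≗ Q′ ν
IsPQ-unique {P} {Q} {P′} {Q′} (_ , polyQ , P₀ , Q₀ , DP , rel) (_ , polyQ′ , P′₀ , Q′₀ , DP′ , rel′) = go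
  where
  go : ∀ ν → P ν ≗ P′ ν × Q ν ≗ Q′ ν
  go zero    = (λ k → trans (P₀ k) (sym (P′₀ k))) , (λ k → trans (Q₀ k) (sym (Q′₀ k)))
  go (suc n) = P-eq , Q-eq
    where
    Pₙ-eq : P n ≗ P′ n
    Pₙ-eq = proj₁ (go n)
    Qₙ-eq : Q n ≗ Q′ n
    Qₙ-eq = proj₂ (go n)

    tail-eq : ∀ k → P (suc n) (suc k) ≡ P′ (suc n) (suc k)
    tail-eq k = natA-cancelˡ (suc k) (trans (DP n k) (trans (Pₙ-eq k) (sym (DP′ n k))))

    δ : Seq
    δ j = Q (suc n) j - Q′ (suc n) j

    δ-step : ∀ j → δ j ≡ natA (2 ℕ.+ j) * δ (2 ℕ.+ j)
    δ-step j = begin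
      Q (suc n) j - Q′ (suc n) j
        ≡⟨ cong₂ _-_ (isolateʳ p (a * Q (suc n) (2 ℕ.+ j)) (Q (suc n) j) (rel n (suc j)))
                     (isolateʳ (P′ (suc n) (suc j)) (a * Q′ (suc n) (2 ℕ.+ j)) (Q′ (suc n) j) (rel′ n (suc j))) ⟩
      (p + a * Q (suc n) (2 ℕ.+ j) - Q n (suc j)) - (P′ (suc n) (suc j) + a * Q′ (suc n) (2 ℕ.+ j) - Q′ n (suc j))
        ≡⟨ cong₂ (λ x y → (p + a * Q (suc n) (2 ℕ.+ j) - Q n (suc j)) - (x + a * Q′ (suc n) (2 ℕ.+ j) - y)) (sym (tail-eq j)) (sym (Qₙ-eq (suc j))) ⟩
      (p + a * Q (suc n) (2 ℕ.+ j) - Q n (suc j)) - (p + a * Q′ (suc n) (2 ℕ.+ j) - Q n (suc j))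
        ≡⟨ solve 5 (λ p a x x′ z → (p :+ a :* x :- z) :- (p :+ a :* x′ :- z) := a :* (x :- x′)) refl p a (Q (suc n) (2 ℕ.+ j)) (Q′ (suc n) (2 ℕ.+ j)) (Q n (suc j)) ⟩
      a * δ (2 ℕ.+ j) ∎
      where
      p = P (suc n) (suc j)
      a = natA (2 ℕ.+ j)

    Q-eq : Q (suc n) ≗ Q′ (suc n)
    Q-eq j = x∙y⁻¹≈ε⇒x≈y (Q (suc n) j) (Q′ (suc n) j)
      (IsPoly-descent δ (IsPoly-− (polyQ (suc n)) (polyQ′ (suc n))) δ-step j)

    P-eq : P (suc n) ≗ P′ (suc n)
    P-eq k = begin
      P (suc n) k                                            ≡⟨ isolateˡ (P (suc n) k) (D (Q (suc n)) k) (X (Q (suc n)) k) (rel n k) ⟩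
      (Q n k + X (Q (suc n)) k) - D (Q (suc n)) k            ≡⟨ cong₂ (λ x y → (x + X (Q (suc n)) k) - y) (Qₙ-eq k) (D-cong Q-eq k) ⟩
      (Q′ n k + X (Q (suc n)) k) - D (Q′ (suc n)) k          ≡⟨ cong (λ x → (Q′ n k + x) - D (Q′ (suc n)) k) (X-cong Q-eq k) ⟩
      (Q′ n k + X (Q′ (suc n)) k) - D (Q′ (suc n)) k         ≡⟨ isolateˡ (P′ (suc n) k) (D (Q′ (suc n)) k) (X (Q′ (suc n)) k) (rel′ n k) ⟨
      P′ (suc n) k                                           ∎

𝒫𝒬-isPQ : IsPQ 𝒫 𝒬
𝒫𝒬-isPQ = (λ ν → suc ν , λ _ → 𝒫-deg) , (λ ν → ν , λ _ → 𝒬-deg) , 𝒫₀ , (λ _ → refl) , D-𝒫 ,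
          λ ν k → cancel-rel (𝒫 (suc ν) k) (D (𝒬 (suc ν)) k) (X (𝒬 (suc ν)) k) (𝒫𝒬-relation ν k)

-- Coefficients of (ξ + d/dξ)ⁿ 1

private
  module ℕ-identities where
    even-step : ∀ A B a k F K W →
      (A ℕ.+ (2 ℕ.+ k) ℕ.* B) ℕ.* ((suc a ℕ.* F) ℕ.* (suc k ℕ.* K) ℕ.* (2 ℕ.* W))
        ≡ suc k ℕ.* (A ℕ.* (suc a ℕ.* F ℕ.* K ℕ.* (2 ℕ.* W))) ℕ.+ 2 ℕ.* suc a ℕ.* (B ℕ.* (F ℕ.* ((2 ℕ.+ k) ℕ.* (suc k ℕ.* K)) ℕ.* W))
    even-step = solve-∀

    even-sum : ∀ a k G → suc k ℕ.* G ℕ.+ 2 ℕ.* suc a ℕ.* G ≡ suc (k ℕ.+ 2 ℕ.* suc a) ℕ.* G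
    even-sum = solve-∀

    even-zero : ∀ a A F W → A ℕ.* (suc a ℕ.* F ℕ.* 1 ℕ.* (2 ℕ.* W)) ≡ 2 ℕ.* suc a ℕ.* (A ℕ.* (F ℕ.* 1 ℕ.* W))
    even-zero = solve-∀

    shift : ∀ k a → 2 ℕ.+ k ℕ.+ 2 ℕ.* a ≡ k ℕ.+ 2 ℕ.* suc a
    shift = solve-∀

    units : ∀ F → 1 ℕ.* (1 ℕ.* F ℕ.* 1) ≡ F
    units = solve-∀

    double-suc : ∀ a → 2 ℕ.* suc a ≡ suc (suc (2 ℕ.* a))
    double-suc = solve-∀
  open ℕ-identities

r-even : ∀ a k → r (k ℕ.+ 2 ℕ.* a) k ℕ.* (a ! ℕ.* k ! ℕ.* 2 ^ a) ≡ (k ℕ.+ 2 ℕ.* a) !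
r-even zero    k rewrite ℕP.+-identityʳ k | r-top k = units (k !)
r-even (suc a) zero = subst (λ n → r n 0 ℕ.* (suc a ! ℕ.* 1 ℕ.* 2 ^ suc a) ≡ n !) (sym (double-suc a)) (begin
  r (1 ℕ.+ 2 ℕ.* a) 1 ℕ.* (suc a ! ℕ.* 1 ℕ.* 2 ^ suc a)              ≡⟨ even-zero a (r (1 ℕ.+ 2 ℕ.* a) 1) (a !) (2 ^ a) ⟩
  2 ℕ.* suc a ℕ.* (r (1 ℕ.+ 2 ℕ.* a) 1 ℕ.* (a ! ℕ.* 1 ℕ.* 2 ^ a))    ≡⟨ cong (2 ℕ.* suc a ℕ.*_) (r-even a 1) ⟩
  2 ℕ.* suc a ℕ.* (1 ℕ.+ 2 ℕ.* a) !                                 ≡⟨ cong (ℕ._* (1 ℕ.+ 2 ℕ.* a) !) (double-suc a) ⟩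
  (2 ℕ.+ 2 ℕ.* a) !                                                 ∎)
r-even (suc a) (suc k) = begin
  (A ℕ.+ (2 ℕ.+ k) ℕ.* B) ℕ.* (suc a ! ℕ.* suc k ! ℕ.* 2 ^ suc a)
    ≡⟨ even-step A B a k (a !) (k !) (2 ^ a) ⟩
  suc k ℕ.* (A ℕ.* (suc a ! ℕ.* k ! ℕ.* 2 ^ suc a)) ℕ.+ 2 ℕ.* suc a ℕ.* (B ℕ.* (a ! ℕ.* (2 ℕ.+ k) ! ℕ.* 2 ^ a))
    ≡⟨ cong₂ (λ x y → suc k ℕ.* x ℕ.+ 2 ℕ.* suc a ℕ.* y) (r-even (suc a) k) lower ⟩
  suc k ℕ.* N ! ℕ.+ 2 ℕ.* suc a ℕ.* N !
    ≡⟨ even-sum a k (N !) ⟩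
  suc N ! ∎
  where
  N = k ℕ.+ 2 ℕ.* suc a
  A = r N k
  B = r N (2 ℕ.+ k)
  lower : B ℕ.* (a ! ℕ.* (2 ℕ.+ k) ! ℕ.* 2 ^ a) ≡ N !
  lower = subst (λ n → r n (2 ℕ.+ k) ℕ.* (a ! ℕ.* (2 ℕ.+ k) ! ℕ.* 2 ^ a) ≡ n !) (shift k a) (r-even a (2 ℕ.+ k))

r-odd : ∀ a k → r (suc (k ℕ.+ 2 ℕ.* a)) k ≡ 0
r-odd zero    zero    = refl
r-odd (suc a) zero    = subst (λ n → r (suc n) 0 ≡ 0) (sym (double-suc a)) (r-odd a 1)
r-odd zero    (suc k) = trans (cong₂ (λ x y → x ℕ.+ (2 ℕ.+ k) ℕ.* y) (r-odd 0 k) (r-deg (s≤s (s≤s (ℕP.≤-reflexive (ℕP.+-identityʳ k))))))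
                              (ℕP.*-zeroʳ (2 ℕ.+ k))
r-odd (suc a) (suc k) = trans (cong₂ (λ x y → x ℕ.+ (2 ℕ.+ k) ℕ.* y) (r-odd (suc a) k) (subst (λ n → r (suc n) (2 ℕ.+ k) ≡ 0) (shift k a) (r-odd a (2 ℕ.+ k))))
                              (ℕP.*-zeroʳ (2 ℕ.+ k))

data Offset : ℕ → ℕ → Set where
  above : ∀ {ν k} → ν < k → Offset ν k
  even  : ∀ a k → Offset (k ℕ.+ 2 ℕ.* a) k
  odd   : ∀ a k → Offset (suc (k ℕ.+ 2 ℕ.* a)) k

offset : ∀ ν k → Offset ν k
offset zero    zero    = even 0 0
offset (suc ν) zero    with offset ν 0
... | even a .0 = odd a 0
... | odd  a .0 = subst (λ n → Offset n 0) (ℕP.*-suc 2 a) (even (suc a) 0)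
offset zero    (suc k) = above (s≤s z≤n)
offset (suc ν) (suc k) with offset ν k
... | above ν<k = above (s≤s ν<k)
... | even a .k = even a (suc k)
... | odd  a .k = odd a (suc k)

pow½-*-2^ : ∀ a → pow ½ a * natA (2 ^ a) ≡ 1ℚ
pow½-*-2^ zero    = refl
pow½-*-2^ (suc a) = begin
  (½ * pow ½ a) * natA (2 ℕ.* 2 ^ a)                   ≡⟨ cong ((½ * pow ½ a) *_) (natA-* 2 (2 ^ a)) ⟩
  (½ * pow ½ a) * (natA 2 * natA (2 ^ a))              ≡⟨ solve 4 (λ h p t w → (h :* p) :* (t :* w) := (h :* t) :* (p :* w)) refl ½ (pow ½ a) (natA 2) (natA (2 ^ a)) ⟩
  (½ * natA 2) * (pow ½ a * natA (2 ^ a))              ≡⟨ cong ((½ * natA 2) *_) (pow½-*-2^ a) ⟩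
  1ℚ                                                   ∎

𝒫-even : ∀ a k → 𝒫 (k ℕ.+ 2 ℕ.* a) k ≡ (invFact a * invFact k) * pow ½ a
𝒫-even a k = inverse-unique {m = natA N} (begin
  𝒫 ν k * natA N                        ≡⟨ cong (_* natA N) (𝒫-coeff ν k) ⟩
  invFact ν * natA (r ν k) * natA N     ≡⟨ ℚP.*-assoc (invFact ν) (natA (r ν k)) (natA N) ⟩
  invFact ν * (natA (r ν k) * natA N)   ≡⟨ cong (invFact ν *_) (sym (natA-* (r ν k) N)) ⟩
  invFact ν * natA (r ν k ℕ.* N)        ≡⟨ cong (λ m → invFact ν * natA m) (r-even a k) ⟩
  invFact ν * natA (ν !)                ≡⟨ invFact-*-! ν ⟩
  1ℚ                                    ∎) (begin
  (invFact a * invFact k) * pow ½ a * natA N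
    ≡⟨ cong ((invFact a * invFact k) * pow ½ a *_) (trans (natA-* (a ! ℕ.* k !) (2 ^ a)) (cong (_* natA (2 ^ a)) (natA-* (a !) (k !)))) ⟩
  (invFact a * invFact k) * pow ½ a * (natA (a !) * natA (k !) * natA (2 ^ a))
    ≡⟨ solve 6 (λ ia ik h A K W → (ia :* ik) :* h :* (A :* K :* W) := (ia :* A) :* (ik :* K) :* (h :* W)) refl
         (invFact a) (invFact k) (pow ½ a) (natA (a !)) (natA (k !)) (natA (2 ^ a)) ⟩
  (invFact a * natA (a !)) * (invFact k * natA (k !)) * (pow ½ a * natA (2 ^ a))
    ≡⟨ cong₂ (λ x y → x * y * (pow ½ a * natA (2 ^ a))) (invFact-*-! a) (invFact-*-! k) ⟩
  1ℚ * 1ℚ * (pow ½ a * natA (2 ^ a))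
    ≡⟨ trans (ℚP.*-identityˡ (pow ½ a * natA (2 ^ a))) (pow½-*-2^ a) ⟩
  1ℚ ∎)
  where
  ν = k ℕ.+ 2 ℕ.* a
  N = a ! ℕ.* k ! ℕ.* 2 ^ a

𝒫-odd : ∀ a k → 𝒫 (suc (k ℕ.+ 2 ℕ.* a)) k ≡ 0ℚ
𝒫-odd a k = trans (𝒫-coeff ν k) (trans (cong (λ m → invFact ν * natA m) (r-odd a k)) (ℚP.*-zeroʳ (invFact ν)))
  where ν = suc (k ℕ.+ 2 ℕ.* a)

𝒫-top : ∀ ν → 𝒫 ν ν ≢ 0ℚ
𝒫-top ν 𝒫νν≡0 = ℚP.1≢0 (begin
  1ℚ                        ≡⟨ sym (invFact-*-! ν) ⟩
  invFact ν * natA (ν !)    ≡⟨ cong (_* natA (ν !)) invFact≡0 ⟩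
  0ℚ * natA (ν !)           ≡⟨ ℚP.*-zeroˡ (natA (ν !)) ⟩
  0ℚ                        ∎)
  where
  invFact≡0 : invFact ν ≡ 0ℚ
  invFact≡0 = trans (sym (trans (𝒫-coeff ν ν) (trans (cong (λ m → invFact ν * natA m) (r-top ν)) (ℚP.*-identityʳ (invFact ν))))) 𝒫νν≡0

sumTo-vanishes : ∀ n h → (∀ b → b ≤ n → h b ≡ 0ℚ) → sumTo n h ≡ 0ℚ
sumTo-vanishes zero    h h≡0 = h≡0 0 z≤n
sumTo-vanishes (suc n) h h≡0 = cong₂ _+_ (sumTo-vanishes n h (λ b b≤n → h≡0 b (ℕP.m≤n⇒m≤1+n b≤n))) (h≡0 (suc n) ℕP.≤-refl)

sumTo-single : ∀ n h {a} → a ≤ n → (∀ b → b ≤ n → b ≢ a → h b ≡ 0ℚ) → sumTo n h ≡ h a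
sumTo-single zero    h z≤n _ = refl
sumTo-single (suc n) h {a} a≤1+n h≡0 with a ℕ.≟ suc n
... | yes refl = trans (cong (_+ h (suc n)) (sumTo-vanishes n h (λ b b≤n → h≡0 b (ℕP.m≤n⇒m≤1+n b≤n) (ℕP.<⇒≢ (s≤s b≤n)))))
                       (ℚP.+-identityˡ (h (suc n)))
... | no  a≢1+n = trans (cong₂ _+_ (sumTo-single n h (ℕ.s≤s⁻¹ (ℕP.≤∧≢⇒< a≤1+n a≢1+n)) (λ b b≤n → h≡0 b (ℕP.m≤n⇒m≤1+n b≤n)))
                                   (h≡0 (suc n) ℕP.≤-refl (≢-sym a≢1+n)))
                        (ℚP.+-identityʳ (h a))

mono-diag : ∀ c j → mono c j j ≡ c
mono-diag c zero    = refl
mono-diag c (suc j) = mono-diag c j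

mono-off : ∀ c {j k} → j ≢ k → mono c j k ≡ 0ℚ
mono-off c {zero}  {zero}  j≢k = ⊥-elim (j≢k refl)
mono-off c {zero}  {suc k} _   = refl
mono-off c {suc j} {zero}  _   = refl
mono-off c {suc j} {suc k} j≢k = mono-off c (j≢k ∘′ cong suc)

⌊double/2⌋ : ∀ a → ⌊ 2 ℕ.* a /2⌋ ≡ a
⌊double/2⌋ zero    = refl
⌊double/2⌋ (suc a) = trans (cong ⌊_/2⌋ (ℕP.*-suc 2 a)) (cong suc (⌊double/2⌋ a))

double⌊/2⌋≤ : ∀ n → 2 ℕ.* ⌊ n /2⌋ ≤ n
double⌊/2⌋≤ zero          = z≤n
double⌊/2⌋≤ (suc zero)    = z≤n
double⌊/2⌋≤ (suc (suc n)) = subst (ℕ._≤ 2 ℕ.+ n) (sym (ℕP.*-suc 2 ⌊ n /2⌋)) (s≤s (s≤s (double⌊/2⌋≤ n)))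

-- ξ^(ν−2a) / (a! (ν−2a)! 2ᵃ); for the summation range a ≤ ⌊ν/2⌋ the subtraction never truncates.
summand : ℕ → ℕ → Seq
summand ν a = mono ((invFact a * invFact (ν ∸ 2 ℕ.* a)) * pow ½ a) (ν ∸ 2 ℕ.* a)

summand-exponent : ∀ {ν k b} → b ≤ ⌊ ν /2⌋ → ν ∸ 2 ℕ.* b ≡ k → ν ≡ k ℕ.+ 2 ℕ.* b
summand-exponent {ν} {k} {b} b≤ ν∸2b≡k = begin
  ν                         ≡⟨ ℕP.m∸n+n≡m (ℕP.≤-trans (ℕP.*-monoʳ-≤ 2 b≤) (double⌊/2⌋≤ ν)) ⟨
  ν ∸ 2 ℕ.* b ℕ.+ 2 ℕ.* b   ≡⟨ cong (ℕ._+ 2 ℕ.* b) ν∸2b≡k ⟩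
  k ℕ.+ 2 ℕ.* b             ∎

𝒫-sum : ∀ ν k → 𝒫 ν k ≡ sumTo ⌊ ν /2⌋ (λ a → summand ν a k)
𝒫-sum ν k with offset ν k
... | above ν<k = trans (𝒫-deg ν<k) (sym (sumTo-vanishes ⌊ ν /2⌋ (λ a → summand ν a k) λ b _ → mono-off _ λ ν∸2b≡k →
                    ℕP.<-irrefl refl (ℕP.≤-<-trans (subst (ℕ._≤ ν) ν∸2b≡k (ℕP.m∸n≤m ν (2 ℕ.* b))) ν<k)))
... | even a .k = trans (𝒫-even a k) (sym (trans (sumTo-single ⌊ ν′ /2⌋ (λ b → summand ν′ b k) a≤ others) picked))
  where
  ν′ = k ℕ.+ 2 ℕ.* a
  ν′∸2a≡k : ν′ ∸ 2 ℕ.* a ≡ k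
  ν′∸2a≡k = ℕP.m+n∸n≡m k (2 ℕ.* a)
  a≤ : a ≤ ⌊ ν′ /2⌋
  a≤ = subst (_≤ ⌊ ν′ /2⌋) (⌊double/2⌋ a) (ℕP.⌊n/2⌋-mono (ℕP.m≤n+m (2 ℕ.* a) k))
  others : ∀ b → b ≤ ⌊ ν′ /2⌋ → b ≢ a → summand ν′ b k ≡ 0ℚ
  others b b≤ b≢a = mono-off _ λ ν′∸2b≡k →
    b≢a (ℕP.*-cancelˡ-≡ b a 2 (ℕP.+-cancelˡ-≡ k _ _ (sym (summand-exponent b≤ ν′∸2b≡k))))
  picked : summand ν′ a k ≡ (invFact a * invFact k) * pow ½ a
  picked rewrite ν′∸2a≡k = mono-diag _ k
... | odd a .k = trans (𝒫-odd a k) (sym (sumTo-vanishes ⌊ ν′ /2⌋ (λ b → summand ν′ b k) λ b b≤ → mono-off _ λ ν′∸2b≡k →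
                   ℕP.even≢odd b a (ℕP.+-cancelˡ-≡ k _ _ (trans (sym (summand-exponent b≤ ν′∸2b≡k)) (sym (ℕP.+-suc k (2 ℕ.* a)))))))
  where
  ν′ = suc (k ℕ.+ 2 ℕ.* a)

pow-−1-+2* : ∀ k a → pow (- 1ℚ) (k ℕ.+ 2 ℕ.* a) ≡ pow (- 1ℚ) k
pow-−1-+2* k zero    = cong (pow (- 1ℚ)) (ℕP.+-identityʳ k)
pow-−1-+2* k (suc a) = begin
  pow (- 1ℚ) (k ℕ.+ 2 ℕ.* suc a)                   ≡⟨ cong (pow (- 1ℚ)) (trans (cong (k ℕ.+_) (ℕP.*-suc 2 a)) (ℕP.+-suc k (suc (2 ℕ.* a)))) ⟩
  pow (- 1ℚ) (suc (k ℕ.+ suc (2 ℕ.* a)))           ≡⟨ cong (λ n → pow (- 1ℚ) (suc n)) (ℕP.+-suc k (2 ℕ.* a)) ⟩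
  - 1ℚ * (- 1ℚ * pow (- 1ℚ) (k ℕ.+ 2 ℕ.* a))      ≡⟨ solve 1 (λ p → con (- 1ℚ) :* (con (- 1ℚ) :* p) := p) refl (pow (- 1ℚ) (k ℕ.+ 2 ℕ.* a)) ⟩
  pow (- 1ℚ) (k ℕ.+ 2 ℕ.* a)                       ≡⟨ pow-−1-+2* k a ⟩
  pow (- 1ℚ) k                                     ∎

𝒫-parity : ∀ ν k → pow (- 1ℚ) k * 𝒫 ν k ≡ pow (- 1ℚ) ν * 𝒫 ν k
𝒫-parity ν k with offset ν k
... | above ν<k rewrite 𝒫-deg ν<k = trans (ℚP.*-zeroʳ (pow (- 1ℚ) k)) (sym (ℚP.*-zeroʳ (pow (- 1ℚ) ν)))
... | even a .k = cong (_* 𝒫 (k ℕ.+ 2 ℕ.* a) k) (sym (pow-−1-+2* k a))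
... | odd  a .k rewrite 𝒫-odd a k = trans (ℚP.*-zeroʳ (pow (- 1ℚ) k)) (sym (ℚP.*-zeroʳ (pow (- 1ℚ) (suc (k ℕ.+ 2 ℕ.* a)))))

𝒫-integral : ∀ ν k → (ℤ.+ (ν !) ℚ./ 1) * 𝒫 ν k ≡ ℤ.+ (r ν k) ℚ./ 1
𝒫-integral ν k = begin
  (ℤ.+ (ν !) ℚ./ 1) * 𝒫 ν k                ≡⟨ cong₂ _*_ (sym (natA≡/1 (ν !))) (𝒫-coeff ν k) ⟩
  natA (ν !) * (invFact ν * natA (r ν k))   ≡⟨ solve 3 (λ a i x → a :* (i :* x) := (i :* a) :* x) refl (natA (ν !)) (invFact ν) (natA (r ν k)) ⟩
  (invFact ν * natA (ν !)) * natA (r ν k)   ≡⟨ cong (_* natA (r ν k)) (invFact-*-! ν) ⟩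
  1ℚ * natA (r ν k)                         ≡⟨ ℚP.*-identityˡ (natA (r ν k)) ⟩
  natA (r ν k)                              ≡⟨ natA≡/1 (r ν k) ⟩
  ℤ.+ (r ν k) ℚ./ 1                         ∎

𝒫-at-0 : ∀ m → 𝒫 (2 ℕ.* m) 0 ≡ pow ½ m * invFact m
𝒫-at-0 m = trans (𝒫-even m 0) (trans (cong (_* pow ½ m) (ℚP.*-identityʳ (invFact m))) (ℚP.*-comm (invFact m) (pow ½ m)))

-- Cauchy products and Gaussian exponentials

sumTo-cong : ∀ n {h h′ : ℕ → ℚ} → (∀ k → k ≤ n → h k ≡ h′ k) → sumTo n h ≡ sumTo n h′
sumTo-cong zero    h≡h′ = h≡h′ 0 z≤n
sumTo-cong (suc n) h≡h′ = cong₂ _+_ (sumTo-cong n (λ k k≤n → h≡h′ k (ℕP.m≤n⇒m≤1+n k≤n))) (h≡h′ (suc n) ℕP.≤-refl)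

sumTo-+ : ∀ n (h g : ℕ → ℚ) → sumTo n (λ k → h k + g k) ≡ sumTo n h + sumTo n g
sumTo-+ zero    h g = refl
sumTo-+ (suc n) h g = trans (cong (_+ (h (suc n) + g (suc n))) (sumTo-+ n h g))
  (solve 4 (λ a b c d → (a :+ b) :+ (c :+ d) := (a :+ c) :+ (b :+ d)) refl (sumTo n h) (sumTo n g) (h (suc n)) (g (suc n)))

*-sumTo : ∀ n c (h : ℕ → ℚ) → c * sumTo n h ≡ sumTo n (λ k → c * h k)
*-sumTo zero    c h = refl
*-sumTo (suc n) c h = trans (ℚP.*-distribˡ-+ c (sumTo n h) (h (suc n))) (cong (_+ c * h (suc n)) (*-sumTo n c h))

sumTo-suc : ∀ n (h : ℕ → ℚ) → sumTo (suc n) h ≡ h 0 + sumTo n (λ k → h (suc k))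
sumTo-suc zero    h = refl
sumTo-suc (suc n) h = trans (cong (_+ h (2 ℕ.+ n)) (sumTo-suc n h)) (ℚP.+-assoc (h 0) _ _)

⋆-congˡ : ∀ {f f′} g → f ≗ f′ → f ⋆ g ≗ f′ ⋆ g
⋆-congˡ g f≗f′ n = sumTo-cong n (λ k _ → cong (_* g (n ∸ k)) (f≗f′ k))

⋆-congʳ : ∀ f {g g′} → g ≗ g′ → f ⋆ g ≗ f ⋆ g′
⋆-congʳ f g≗g′ n = sumTo-cong n (λ k _ → cong (f k *_) (g≗g′ (n ∸ k)))

·-⋆ : ∀ c f g → (c · f) ⋆ g ≗ c · (f ⋆ g)
·-⋆ c f g n = trans (sumTo-cong n (λ k _ → ℚP.*-assoc c (f k) (g (n ∸ k)))) (sym (*-sumTo n c (λ k → f k * g (n ∸ k))))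

⋆-· : ∀ c f g → f ⋆ (c · g) ≗ c · (f ⋆ g)
⋆-· c f g n = trans (sumTo-cong n (λ k _ → solve 3 (λ c x y → x :* (c :* y) := c :* (x :* y)) refl c (f k) (g (n ∸ k))))
                    (sym (*-sumTo n c (λ k → f k * g (n ∸ k))))

X-⋆ : ∀ f g → X f ⋆ g ≗ X (f ⋆ g)
X-⋆ f g zero    = ℚP.*-zeroˡ (g 0)
X-⋆ f g (suc n) = trans (sumTo-suc n (λ k → X f k * g (suc n ∸ k)))
                        (trans (cong (_+ (f ⋆ g) n) (ℚP.*-zeroˡ (g (suc n)))) (ℚP.+-identityˡ ((f ⋆ g) n)))

⋆-X : ∀ f g → f ⋆ X g ≗ X (f ⋆ g)
⋆-X f g zero    = ℚP.*-zeroʳ (f 0)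
⋆-X f g (suc n) = begin
  sumTo n (λ k → f k * X g (suc n ∸ k)) + f (suc n) * X g (n ∸ n)
    ≡⟨ cong₂ _+_ (sumTo-cong n (λ k k≤n → cong (λ m → f k * X g m) (ℕP.+-∸-assoc 1 k≤n)))
                 (cong (λ m → f (suc n) * X g m) (ℕP.n∸n≡0 n)) ⟩
  (f ⋆ g) n + f (suc n) * 0ℚ
    ≡⟨ trans (cong ((f ⋆ g) n +_) (ℚP.*-zeroʳ (f (suc n)))) (ℚP.+-identityʳ ((f ⋆ g) n)) ⟩
  (f ⋆ g) n ∎

leibniz : ∀ f g → D (f ⋆ g) ≗ (D f ⋆ g) ⊕ (f ⋆ D g)
leibniz f g n = begin
  natA (suc n) * sumTo (suc n) h
    ≡⟨ *-sumTo (suc n) (natA (suc n)) h ⟩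
  sumTo (suc n) (λ k → natA (suc n) * h k)
    ≡⟨ sumTo-cong (suc n) (λ k k≤ → trans (cong (λ m → natA m * h k) (sym (ℕP.m+[n∸m]≡n k≤)))
                                          (trans (cong (_* h k) (natA-+ k (suc n ∸ k))) (ℚP.*-distribʳ-+ (h k) (natA k) (natA (suc n ∸ k))))) ⟩
  sumTo (suc n) (λ k → natA k * h k + natA (suc n ∸ k) * h k)
    ≡⟨ sumTo-+ (suc n) (λ k → natA k * h k) (λ k → natA (suc n ∸ k) * h k) ⟩
  sumTo (suc n) (λ k → natA k * h k) + sumTo (suc n) (λ k → natA (suc n ∸ k) * h k)
    ≡⟨ cong₂ _+_ left right ⟩
  (D f ⋆ g) n + (f ⋆ D g) n ∎
  where
  h : ℕ → ℚ
  h k = f k * g (suc n ∸ k)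
  left : sumTo (suc n) (λ k → natA k * h k) ≡ (D f ⋆ g) n
  left = trans (sumTo-suc n (λ k → natA k * h k))
        (trans (cong (_+ sumTo n (λ k → natA (suc k) * h (suc k))) (ℚP.*-zeroˡ (h 0)))
        (trans (ℚP.+-identityˡ _) (sumTo-cong n (λ k _ → sym (ℚP.*-assoc (natA (suc k)) (f (suc k)) (g (n ∸ k)))))))
  right : sumTo (suc n) (λ k → natA (suc n ∸ k) * h k) ≡ (f ⋆ D g) n
  right = begin
    sumTo n (λ k → natA (suc n ∸ k) * h k) + natA (n ∸ n) * h (suc n)
      ≡⟨ cong (λ m → sumTo n (λ k → natA (suc n ∸ k) * h k) + natA m * h (suc n)) (ℕP.n∸n≡0 n) ⟩
    sumTo n (λ k → natA (suc n ∸ k) * h k) + 0ℚ * h (suc n)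
      ≡⟨ trans (cong (sumTo n (λ k → natA (suc n ∸ k) * h k) +_) (ℚP.*-zeroˡ (h (suc n)))) (ℚP.+-identityʳ _) ⟩
    sumTo n (λ k → natA (suc n ∸ k) * h k)
      ≡⟨ sumTo-cong n (λ k k≤n → trans (cong (λ m → natA m * (f k * g m)) (ℕP.+-∸-assoc 1 k≤n))
           (solve 3 (λ a x y → a :* (x :* y) := x :* (a :* y)) refl (natA (suc (n ∸ k))) (f k) (g (suc (n ∸ k))))) ⟩
    (f ⋆ D g) n ∎

expSq-even : ∀ c a → expSq c (2 ℕ.* a) ≡ pow c a * invFact a
expSq-even c a = trans (evaluate (2 ℕ.* a) (trans (cong (_% 2) (ℕP.*-comm 2 a)) (m*n%n≡0 a 2))) (cong (λ m → pow c m * invFact m) (⌊double/2⌋ a))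
  where
  evaluate : ∀ n → n % 2 ≡ 0 → expSq c n ≡ pow c ⌊ n /2⌋ * invFact ⌊ n /2⌋
  evaluate n n%2≡0 with n % 2
  evaluate n refl | .0 = refl

expSq-odd : ∀ c a → expSq c (suc (2 ℕ.* a)) ≡ 0ℚ
expSq-odd c a = evaluate (suc (2 ℕ.* a)) (trans (cong (λ m → suc m % 2) (ℕP.*-comm 2 a)) ([m+kn]%n≡m%n 1 a 2))
  where
  evaluate : ∀ n → n % 2 ≡ 1 → expSq c n ≡ 0ℚ
  evaluate n n%2≡1 with n % 2
  evaluate n refl | .1 = refl

D-expSq : ∀ c → D (expSq c) ≗ (c + c) · X (expSq c)
D-expSq c zero    = sym (ℚP.*-zeroʳ (c + c))
D-expSq c (suc j) with offset j 0
... | even a .0 = begin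
  natA (2 ℕ.+ 2 ℕ.* a) * expSq c (2 ℕ.+ 2 ℕ.* a)               ≡⟨ cong (λ m → natA m * expSq c m) (sym (ℕP.*-suc 2 a)) ⟩
  natA (2 ℕ.* suc a) * expSq c (2 ℕ.* suc a)                   ≡⟨ cong₂ _*_ (natA-* 2 (suc a)) (expSq-even c (suc a)) ⟩
  natA 2 * natA (suc a) * (c * pow c a * invFact (suc a))      ≡⟨ solve 4 (λ n c p i → con (natA 2) :* n :* (c :* p :* i) := (c :+ c) :* p :* (i :* n)) refl (natA (suc a)) c (pow c a) (invFact (suc a)) ⟩
  (c + c) * pow c a * (invFact (suc a) * natA (suc a))         ≡⟨ cong ((c + c) * pow c a *_) (invFact-suc a) ⟩
  (c + c) * pow c a * invFact a                                ≡⟨ ℚP.*-assoc (c + c) (pow c a) (invFact a) ⟩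
  (c + c) * (pow c a * invFact a)                              ≡⟨ cong ((c + c) *_) (expSq-even c a) ⟨
  (c + c) * expSq c (2 ℕ.* a)                                  ∎
... | odd a .0 = begin
  natA (3 ℕ.+ 2 ℕ.* a) * expSq c (3 ℕ.+ 2 ℕ.* a)               ≡⟨ cong (λ m → natA (suc m) * expSq c (suc m)) (sym (ℕP.*-suc 2 a)) ⟩
  natA (suc (2 ℕ.* suc a)) * expSq c (suc (2 ℕ.* suc a))       ≡⟨ cong (natA (suc (2 ℕ.* suc a)) *_) (expSq-odd c (suc a)) ⟩
  natA (suc (2 ℕ.* suc a)) * 0ℚ                                ≡⟨ ℚP.*-zeroʳ (natA (suc (2 ℕ.* suc a))) ⟩
  0ℚ                                                           ≡⟨ ℚP.*-zeroʳ (c + c) ⟨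
  (c + c) * 0ℚ                                                 ≡⟨ cong ((c + c) *_) (expSq-odd c a) ⟨
  (c + c) * expSq c (suc (2 ℕ.* a))                            ∎

-- The product is 1 at ξ = 0 and its derivative vanishes.
expSq-⋆-inverse : ∀ c → expSq (- c) ⋆ expSq c ≗ const 1ℚ
expSq-⋆-inverse c zero    = refl
expSq-⋆-inverse c (suc k) = natA-cancelˡ (suc k) (begin
  D F k                                                                ≡⟨ leibniz (expSq (- c)) (expSq c) k ⟩
  (D (expSq (- c)) ⋆ expSq c) k + (expSq (- c) ⋆ D (expSq c)) k        ≡⟨ cong₂ _+_ (⋆-congˡ (expSq c) (D-expSq (- c)) k) (⋆-congʳ (expSq (- c)) (D-expSq c) k) ⟩
  (((- c + - c) · X (expSq (- c))) ⋆ expSq c) k + (expSq (- c) ⋆ ((c + c) · X (expSq c))) k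
    ≡⟨ cong₂ _+_ (trans (·-⋆ (- c + - c) (X (expSq (- c))) (expSq c) k) (cong ((- c + - c) *_) (X-⋆ (expSq (- c)) (expSq c) k)))
                 (trans (⋆-· (c + c) (expSq (- c)) (X (expSq c)) k) (cong ((c + c) *_) (⋆-X (expSq (- c)) (expSq c) k))) ⟩
  (- c + - c) * X F k + (c + c) * X F k                                ≡⟨ solve 2 (λ c x → (:- c :+ :- c) :* x :+ (c :+ c) :* x := con 0ℚ) refl c (X F k) ⟩
  0ℚ                                                                   ≡⟨ ℚP.*-zeroʳ (natA (suc k)) ⟨
  natA (suc k) * 0ℚ                                                    ∎)
  where F = expSq (- c) ⋆ expSq c

conjugate-Dⁿ : ∀ c n → expSq (- c) ⋆ Dⁿ n (expSq c) ≗ iter n (λ f → ((c + c) · X f) ⊕ D f) (const 1ℚ)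
conjugate-Dⁿ c zero      = expSq-⋆-inverse c
conjugate-Dⁿ c (suc n) k = begin
  (E₋ ⋆ D F) k                          ≡⟨ solve 2 (λ x y → y := (x :+ y) :- x) refl ((D E₋ ⋆ F) k) ((E₋ ⋆ D F) k) ⟩
  ((D E₋ ⋆ F) k + (E₋ ⋆ D F) k) - (D E₋ ⋆ F) k  ≡⟨ cong (_- (D E₋ ⋆ F) k) (sym (leibniz E₋ F k)) ⟩
  D (E₋ ⋆ F) k - (D E₋ ⋆ F) k           ≡⟨ cong₂ _-_ (D-cong (conjugate-Dⁿ c n) k) derivative-of-E₋ ⟩
  D G k - (- c + - c) * X G k           ≡⟨ solve 3 (λ c x y → y :- (:- c :+ :- c) :* x := (c :+ c) :* x :+ y) refl c (X G k) (D G k) ⟩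
  (c + c) * X G k + D G k               ∎
  where
  E₋ = expSq (- c)
  F = Dⁿ n (expSq c)
  G = iter n (λ f → ((c + c) · X f) ⊕ D f) (const 1ℚ)
  derivative-of-E₋ : (D E₋ ⋆ F) k ≡ (- c + - c) * X G k
  derivative-of-E₋ = trans (⋆-congˡ F (D-expSq (- c)) k) (trans (·-⋆ (- c + - c) (X E₋) F k)
                       (cong ((- c + - c) *_) (trans (X-⋆ E₋ F k) (X-cong (conjugate-Dⁿ c n) k))))

-- Hermite polynomials

iter-cong : ∀ n {T T′ : Seq → Seq} → (∀ {f g} → f ≗ g → T f ≗ T′ g) → ∀ {f g} → f ≗ g → iter n T f ≗ iter n T′ g
iter-cong zero    T≗T′ f≗g = f≗g
iter-cong (suc n) T≗T′ f≗g = T≗T′ (iter-cong n T≗T′ f≗g)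

E⁻⋆Dⁿ-E⁺ : ∀ n → E⁻ ⋆ Dⁿ n E⁺ ≗ R n
E⁻⋆Dⁿ-E⁺ n k = trans (conjugate-Dⁿ ½ n k)
  (iter-cong n (λ f≗g j → cong₂ _+_ (trans (ℚP.*-identityˡ _) (X-cong f≗g j)) (D-cong f≗g j)) (λ _ → refl) k)

H : ℕ → Seq
H n = iter n (λ f → ((- 1ℚ) · X f) ⊕ D f) (const 1ℚ)

E⁺⋆Dⁿ-E⁻ : ∀ n → E⁺ ⋆ Dⁿ n E⁻ ≗ H n
E⁺⋆Dⁿ-E⁻ = conjugate-Dⁿ (- ½)

-ᶜ_ : ℚi → ℚi
-ᶜ (a +i b) = (- a) +i (- b)

ℚi-isCommutativeRing : IsCommutativeRing _≡_ _+ᶜ_ _*ᶜ_ -ᶜ_ (ι 0ℚ) (ι 1ℚ)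
ℚi-isCommutativeRing = record
  { isRing = record
    { +-isAbelianGroup = record
      { isGroup = record
        { isMonoid = record
          { isSemigroup = record
            { isMagma = record { isEquivalence = isEquivalence ; ∙-cong = cong₂ _+ᶜ_ }
            ; assoc = λ { (a +i b) (c +i d) (e +i f) → cong₂ _+i_ (ℚP.+-assoc a c e) (ℚP.+-assoc b d f) } }
          ; identity = (λ { (a +i b) → cong₂ _+i_ (ℚP.+-identityˡ a) (ℚP.+-identityˡ b) })
                     , (λ { (a +i b) → cong₂ _+i_ (ℚP.+-identityʳ a) (ℚP.+-identityʳ b) }) }
        ; inverse = (λ { (a +i b) → cong₂ _+i_ (ℚP.+-inverseˡ a) (ℚP.+-inverseˡ b) })
                  , (λ { (a +i b) → cong₂ _+i_ (ℚP.+-inverseʳ a) (ℚP.+-inverseʳ b) })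
        ; ⁻¹-cong = cong -ᶜ_ }
      ; comm = λ { (a +i b) (c +i d) → cong₂ _+i_ (ℚP.+-comm a c) (ℚP.+-comm b d) } }
    ; *-cong = cong₂ _*ᶜ_
    ; *-assoc = λ { (a +i b) (c +i d) (e +i f) → cong₂ _+i_
        (solve 6 (λ a b c d e f → ((a :* c) :- (b :* d)) :* e :- ((a :* d) :+ (b :* c)) :* f := a :* ((c :* e) :- (d :* f)) :- b :* ((c :* f) :+ (d :* e))) refl a b c d e f)
        (solve 6 (λ a b c d e f → ((a :* c) :- (b :* d)) :* f :+ ((a :* d) :+ (b :* c)) :* e := a :* ((c :* f) :+ (d :* e)) :+ b :* ((c :* e) :- (d :* f))) refl a b c d e f) }
    ; *-identity = (λ { (a +i b) → cong₂ _+i_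
                      (solve 2 (λ a b → (con 1ℚ :* a) :- (con 0ℚ :* b) := a) refl a b)
                      (solve 2 (λ a b → (con 1ℚ :* b) :+ (con 0ℚ :* a) := b) refl a b) })
                 , (λ { (a +i b) → cong₂ _+i_
                      (solve 2 (λ a b → (a :* con 1ℚ) :- (b :* con 0ℚ) := a) refl a b)
                      (solve 2 (λ a b → (a :* con 0ℚ) :+ (b :* con 1ℚ) := b) refl a b) })
    ; distrib = (λ { (a +i b) (c +i d) (e +i f) → cong₂ _+i_
                   (solve 6 (λ a b c d e f → (a :* (c :+ e)) :- (b :* (d :+ f)) := ((a :* c) :- (b :* d)) :+ ((a :* e) :- (b :* f))) refl a b c d e f)
                   (solve 6 (λ a b c d e f → (a :* (d :+ f)) :+ (b :* (c :+ e)) := ((a :* d) :+ (b :* c)) :+ ((a :* f) :+ (b :* e))) refl a b c d e f) })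
              , (λ { (a +i b) (c +i d) (e +i f) → cong₂ _+i_
                   (solve 6 (λ a b c d e f → ((c :+ e) :* a) :- ((d :+ f) :* b) := ((c :* a) :- (d :* b)) :+ ((e :* a) :- (f :* b))) refl a b c d e f)
                   (solve 6 (λ a b c d e f → ((c :+ e) :* b) :+ ((d :+ f) :* a) := ((c :* b) :+ (d :* a)) :+ ((e :* b) :+ (f :* a))) refl a b c d e f) }) }
  ; *-comm = λ { (a +i b) (c +i d) → cong₂ _+i_
      (solve 4 (λ a b c d → (a :* c) :- (b :* d) := (c :* a) :- (d :* b)) refl a b c d)
      (solve 4 (λ a b c d → (a :* d) :+ (b :* c) := (c :* b) :+ (d :* a)) refl a b c d) } }

ℚi-commutativeRing : CommutativeRing 0ℓ 0ℓ
ℚi-commutativeRing = record { isCommutativeRing = ℚi-isCommutativeRing }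

_≟ᶜ_ : DecidableEquality ℚi
(a +i b) ≟ᶜ (c +i d) with a ℚP.≟ c | b ℚP.≟ d
... | yes refl | yes refl = yes refl
... | no  a≢c  | _        = no λ { refl → a≢c refl }
... | yes _    | no  b≢d  = no λ { refl → b≢d refl }

module ℚi-Solver = SimpleSolver (ACR.fromCommutativeRing ℚi-commutativeRing) _≟ᶜ_

ι-* : ∀ a b → ι (a * b) ≡ ι a *ᶜ ι b
ι-* a b = cong₂ _+i_ (solve 2 (λ a b → a :* b := (a :* b) :- (con 0ℚ :* con 0ℚ)) refl a b)
                     (solve 2 (λ a b → con 0ℚ := (a :* con 0ℚ) :+ (con 0ℚ :* b)) refl a b)

open CommutativeRing ℚi-commutativeRing using () renaming (*-identityˡ to *ᶜ-identityˡ)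
open ℚi-Solver using () renaming (solve to solveᶜ; con to conᶜ; _:+_ to _:+ᶜ_; _:*_ to _:*ᶜ_; _:=_ to _:=ᶜ_)

-- Under ξ ↦ iξ the operator d/dξ - ξ becomes -i (ξ + d/dξ); this is its effect on coefficients.
iⁿ⁺ᵏ-H≡R : ∀ n k → C.pow 𝕚 n *ᶜ (C.pow 𝕚 k *ᶜ ι (H n k)) ≡ ι (R n k)
iⁿ⁺ᵏ-H≡R zero    zero    = refl
iⁿ⁺ᵏ-H≡R zero    (suc k) = solveᶜ 1 (λ u → conᶜ (ι 1ℚ) :*ᶜ (u :*ᶜ conᶜ (ι 0ℚ)) :=ᶜ conᶜ (ι 0ℚ)) refl (C.pow 𝕚 (suc k))
iⁿ⁺ᵏ-H≡R (suc n) zero    = begin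
  (𝕚 *ᶜ iⁿ) *ᶜ (ι 1ℚ *ᶜ ι (- 1ℚ * 0ℚ + natA 1 * H n 1))   ≡⟨ cong (λ x → (𝕚 *ᶜ iⁿ) *ᶜ (ι 1ℚ *ᶜ ι x)) (solve 1 (λ h → con (- 1ℚ) :* con 0ℚ :+ con 1ℚ :* h := h) refl (H n 1)) ⟩
  (𝕚 *ᶜ iⁿ) *ᶜ (ι 1ℚ *ᶜ ι (H n 1))                         ≡⟨ solveᶜ 3 (λ i v h → (i :*ᶜ v) :*ᶜ (conᶜ (ι 1ℚ) :*ᶜ h) :=ᶜ v :*ᶜ ((i :*ᶜ conᶜ (ι 1ℚ)) :*ᶜ h)) refl 𝕚 iⁿ (ι (H n 1)) ⟩
  iⁿ *ᶜ (C.pow 𝕚 1 *ᶜ ι (H n 1))                            ≡⟨ iⁿ⁺ᵏ-H≡R n 1 ⟩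
  ι (R n 1)                                                 ≡⟨ cong ι (solve 1 (λ x → x := con 0ℚ :+ con 1ℚ :* x) refl (R n 1)) ⟩
  ι (0ℚ + natA 1 * R n 1)                                   ∎
  where iⁿ = C.pow 𝕚 n
iⁿ⁺ᵏ-H≡R (suc n) (suc j) = begin
  (𝕚 *ᶜ iⁿ) *ᶜ ((𝕚 *ᶜ iʲ) *ᶜ ι (- 1ℚ * H n j + a * H n (2 ℕ.+ j)))
    ≡⟨ cong (λ x → (𝕚 *ᶜ iⁿ) *ᶜ ((𝕚 *ᶜ iʲ) *ᶜ (x +ᶜ ι (a * H n (2 ℕ.+ j))))) (ι-* (- 1ℚ) (H n j)) ⟩
  (𝕚 *ᶜ iⁿ) *ᶜ ((𝕚 *ᶜ iʲ) *ᶜ ((ι (- 1ℚ) *ᶜ ι (H n j)) +ᶜ ι (a * H n (2 ℕ.+ j))))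
    ≡⟨ cong (λ x → (𝕚 *ᶜ iⁿ) *ᶜ ((𝕚 *ᶜ iʲ) *ᶜ ((ι (- 1ℚ) *ᶜ ι (H n j)) +ᶜ x))) (ι-* a (H n (2 ℕ.+ j))) ⟩
  (𝕚 *ᶜ iⁿ) *ᶜ ((𝕚 *ᶜ iʲ) *ᶜ ((ι (- 1ℚ) *ᶜ ι (H n j)) +ᶜ (ι a *ᶜ ι (H n (2 ℕ.+ j)))))
    ≡⟨ solveᶜ 7 (λ i v w m A h₀ h₂ → (i :*ᶜ v) :*ᶜ ((i :*ᶜ w) :*ᶜ ((m :*ᶜ h₀) :+ᶜ (A :*ᶜ h₂)))
                  :=ᶜ (m :*ᶜ (i :*ᶜ i)) :*ᶜ (v :*ᶜ (w :*ᶜ h₀)) :+ᶜ A :*ᶜ (v :*ᶜ ((i :*ᶜ (i :*ᶜ w)) :*ᶜ h₂)))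
          refl 𝕚 iⁿ iʲ (ι (- 1ℚ)) (ι a) (ι (H n j)) (ι (H n (2 ℕ.+ j))) ⟩
  ((ι (- 1ℚ) *ᶜ (𝕚 *ᶜ 𝕚)) *ᶜ (iⁿ *ᶜ (iʲ *ᶜ ι (H n j)))) +ᶜ (ι a *ᶜ (iⁿ *ᶜ (C.pow 𝕚 (2 ℕ.+ j) *ᶜ ι (H n (2 ℕ.+ j)))))
    ≡⟨ cong₂ (λ x y → x +ᶜ (ι a *ᶜ y)) (trans (*ᶜ-identityˡ _) (iⁿ⁺ᵏ-H≡R n j)) (iⁿ⁺ᵏ-H≡R n (2 ℕ.+ j)) ⟩
  ι (R n j) +ᶜ (ι a *ᶜ ι (R n (2 ℕ.+ j)))
    ≡⟨ cong (ι (R n j) +ᶜ_) (sym (ι-* a (R n (2 ℕ.+ j)))) ⟩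
  ι (R n j + a * R n (2 ℕ.+ j)) ∎
  where
  iⁿ = C.pow 𝕚 n
  iʲ = C.pow 𝕚 j
  a = natA (2 ℕ.+ j)

[−i]ⁿ[−1]ⁿ≡iⁿ : ∀ n → C.pow (0ℚ +i (- 1ℚ)) n *ᶜ ι (pow (- 1ℚ) n) ≡ C.pow 𝕚 n
[−i]ⁿ[−1]ⁿ≡iⁿ zero    = refl
[−i]ⁿ[−1]ⁿ≡iⁿ (suc n) = begin
  (−i *ᶜ C.pow −i n) *ᶜ ι (- 1ℚ * pow (- 1ℚ) n)               ≡⟨ cong ((−i *ᶜ C.pow −i n) *ᶜ_) (ι-* (- 1ℚ) (pow (- 1ℚ) n)) ⟩
  (−i *ᶜ C.pow −i n) *ᶜ (ι (- 1ℚ) *ᶜ ι (pow (- 1ℚ) n))        ≡⟨ solveᶜ 4 (λ m v a s → (m :*ᶜ v) :*ᶜ (a :*ᶜ s) :=ᶜ (m :*ᶜ a) :*ᶜ (v :*ᶜ s)) refl −i (C.pow −i n) (ι (- 1ℚ)) (ι (pow (- 1ℚ) n)) ⟩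
  (−i *ᶜ ι (- 1ℚ)) *ᶜ (C.pow −i n *ᶜ ι (pow (- 1ℚ) n))        ≡⟨ cong ((−i *ᶜ ι (- 1ℚ)) *ᶜ_) ([−i]ⁿ[−1]ⁿ≡iⁿ n) ⟩
  𝕚 *ᶜ C.pow 𝕚 n                                              ∎
  where −i = 0ℚ +i (- 1ℚ)

𝒫-hermite : ∀ ν k → ι (𝒫 ν k) ≡ (C.pow (0ℚ +i (- 1ℚ)) ν *ᶜ ι (invFact ν)) *ᶜ substI (He ν) k
𝒫-hermite ν k = begin
  ι (invFact ν * R ν k)                                          ≡⟨ ι-* (invFact ν) (R ν k) ⟩
  ι (invFact ν) *ᶜ ι (R ν k)                                     ≡⟨ cong (ι (invFact ν) *ᶜ_) (sym (iⁿ⁺ᵏ-H≡R ν k)) ⟩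
  ι (invFact ν) *ᶜ (C.pow 𝕚 ν *ᶜ (iᵏ *ᶜ ι (H ν k)))               ≡⟨ cong (λ x → ι (invFact ν) *ᶜ (x *ᶜ (iᵏ *ᶜ ι (H ν k)))) (sym ([−i]ⁿ[−1]ⁿ≡iⁿ ν)) ⟩
  ι (invFact ν) *ᶜ ((C.pow −i ν *ᶜ ι s) *ᶜ (iᵏ *ᶜ ι (H ν k)))
    ≡⟨ solveᶜ 5 (λ f v s w h → f :*ᶜ ((v :*ᶜ s) :*ᶜ (w :*ᶜ h)) :=ᶜ (v :*ᶜ f) :*ᶜ (w :*ᶜ (s :*ᶜ h))) refl (ι (invFact ν)) (C.pow −i ν) (ι s) iᵏ (ι (H ν k)) ⟩
  (C.pow −i ν *ᶜ ι (invFact ν)) *ᶜ (iᵏ *ᶜ (ι s *ᶜ ι (H ν k)))    ≡⟨ cong (λ x → (C.pow −i ν *ᶜ ι (invFact ν)) *ᶜ (iᵏ *ᶜ x)) (sym (ι-* s (H ν k))) ⟩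
  (C.pow −i ν *ᶜ ι (invFact ν)) *ᶜ (iᵏ *ᶜ ι (s * H ν k))         ≡⟨ cong (λ x → (C.pow −i ν *ᶜ ι (invFact ν)) *ᶜ (iᵏ *ᶜ ι (s * x))) (sym (E⁺⋆Dⁿ-E⁻ ν k)) ⟩
  (C.pow −i ν *ᶜ ι (invFact ν)) *ᶜ substI (He ν) k              ∎
  where
  −i = 0ℚ +i (- 1ℚ)
  iᵏ = C.pow 𝕚 k
  s = pow (- 1ℚ) ν

corollary3p7 : (P Q : ℕ → Seq) → IsPQ P Q → (ν : ℕ) →
    (∀ k → ι (P ν k) ≡ (C.pow (0ℚ +i (ℚ.- 1ℚ)) ν *ᶜ ι (invFact ν)) *ᶜ substI (He ν) k) ×
    (∀ k → P ν k ≡ invFact ν ℚ.* (E⁻ ⋆ Dⁿ ν E⁺) k) ×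
    (∀ k → P ν k ≡ iter ν (λ f → X f ⊕ D f) (const (invFact ν)) k) ×
    (∀ k → P ν k ≡ sumTo ⌊ ν /2⌋ (λ a →
        mono ((invFact a ℚ.* invFact (ν ∸ 2 ℕ.* a)) ℚ.* pow ½ a) (ν ∸ 2 ℕ.* a) k)) ×
    (P ν ν ≢ 0ℚ × (∀ k → ν < k → P ν k ≡ 0ℚ)) ×
    (∀ k → pow (ℚ.- 1ℚ) k ℚ.* P ν k ≡ pow (ℚ.- 1ℚ) ν ℚ.* P ν k) ×
    (∀ k → ∃ λ (z : ℤ) → (ℤ.+ (ν !) ℚ./ 1) ℚ.* P ν k ≡ z ℚ./ 1) ×
    (∀ m → (ν ≡ 2 ℕ.* m → P ν 0 ≡ pow ½ m ℚ.* invFact m) ×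
           (ν ≡ suc (2 ℕ.* m) → P ν 0 ≡ 0ℚ))
corollary3p7 P Q isPQ ν =
  (λ k → trans (cong ι (P≗𝒫 k)) (𝒫-hermite ν k)) ,
  (λ k → trans (P≗𝒫 k) (cong (invFact ν *_) (sym (E⁻⋆Dⁿ-E⁺ ν k)))) ,
  (λ k → trans (P≗𝒫 k) (sym (iter-ξ+∂-const ν (invFact ν) k))) ,
  (λ k → trans (P≗𝒫 k) (𝒫-sum ν k)) ,
  ((λ Pνν≡0 → 𝒫-top ν (trans (sym (P≗𝒫 ν)) Pνν≡0)) , (λ k ν<k → trans (P≗𝒫 k) (𝒫-deg ν<k))) ,
  (λ k → subst (λ x → pow (- 1ℚ) k * x ≡ pow (- 1ℚ) ν * x) (sym (P≗𝒫 k)) (𝒫-parity ν k)) ,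
  (λ k → ℤ.+ r ν k , trans (cong ((ℤ.+ (ν !) ℚ./ 1) *_) (P≗𝒫 k)) (𝒫-integral ν k)) ,
  (λ m → (λ { refl → trans (P≗𝒫 0) (𝒫-at-0 m) }) , (λ { refl → trans (P≗𝒫 0) (𝒫-odd m 0) }))
  where
  P≗𝒫 : P ν ≗ 𝒫 ν
  P≗𝒫 = proj₁ (IsPQ-unique isPQ 𝒫𝒬-isPQ ν)
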